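{- For an odd integer $k\ge 9$, the graph $\mathrm{Y}(k)=T_2(k,2,1)$ is vertex-transitive.
   Context: For a positive integer $k$ and $r,s\in\mathbb{Z}_{2k}$, $T_2(k,r,s)$ is the graph with vertex set $\{u_i,v_i,w_i: i\in\mathbb{Z}_{2k}\}$ and edges $w_iw_{i+k}$, $u_iv_i$, $u_iw_i$, $u_iw_{i+r}$, $v_iv_{i+s}$ ($i\in\mathbb{Z}_{2k}$). -}

module Defs where

open import Data.Nat.Base using (ℕ; _+_; _*_; NonZero)
open import Data.Nat.Properties using (m*n≢0)
open import Data.Nat.DivMod using (_mod_)
open import Data.Fin.Base using (Fin; toℕ)
open import Data.Product using (_×_; _,_; Σ)
open import Data.Sum using (_⊎_)
open import Function.Bundles using (_↔_; Inverse)
open import Relation.Binary.PropositionalEquality using (_≡_)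

ℤ₂ₖ : ℕ → Set
ℤ₂ₖ k = Fin (2 * k)

_⊕_ : ∀ {k} .{{_ : NonZero k}} → ℤ₂ₖ k → ℕ → ℤ₂ₖ k
_⊕_ {k} i r = (toℕ i + r) mod (2 * k)
  where instance _ = m*n≢0 2 k

data Kind : Set where
  u v w : Kind

Vertex : ℕ → Set
Vertex k = Kind × ℤ₂ₖ k

data Edge (k r s : ℕ) .{{_ : NonZero k}} : Vertex k → Vertex k → Set where
  e-ww  : ∀ i → Edge k r s (w , i) (w , i ⊕ k)
  e-uv  : ∀ i → Edge k r s (u , i) (v , i)
  e-uw  : ∀ i → Edge k r s (u , i) (w , i)
  e-uwr : ∀ i → Edge k r s (u , i) (w , i ⊕ r)
  e-vv  : ∀ i → Edge k r s (v , i) (v , i ⊕ s)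

T₂ : (k r s : ℕ) .{{_ : NonZero k}} → Vertex k → Vertex k → Set
T₂ k r s x y = Edge k r s x y ⊎ Edge k r s y x

record Automorphism {V : Set} (Adj : V → V → Set) : Set where
  field
    perm     : V ↔ V
  open Inverse perm public using (to; from)
  field
    preserve : ∀ x y → Adj x y → Adj (to x) (to y)
    reflect  : ∀ x y → Adj (to x) (to y) → Adj x y

VertexTransitive : {V : Set} → (V → V → Set) → Set
VertexTransitive {V} Adj =
  ∀ (x y : V) → Σ (Automorphism Adj) λ σ → Automorphism.to σ x ≡ y

Y : (k : ℕ) .{{_ : NonZero k}} → Vertex k → Vertex k → Set
Y k = T₂ k 2 1

module Submission where

open import Defs
open import Data.Nat.Base using (ℕ; _≤_; NonZero)
open import Data.Nat.Divisibility using (_∣_)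
open import Relation.Nullary using (¬_)

open import Data.Nat.Base as ℕ using (zero; suc; parity; _%_)
import Data.Nat.Properties as ℕ
open import Data.Nat.DivMod using (_mod_; m<n⇒m%n≡m)
open import Data.Nat.Divisibility using (divides)
open import Data.Integer.Base using (ℤ; +_; -_; _+_; _-_; _*_; ∣_∣; _%ℕ_; _/ℕ_)
open import Data.Integer.Properties
  using (+-injective; m-n≡m⊖n; ∣m⊝n∣≤m⊔n; ∣i*j∣≡∣i∣*∣j∣; ∣i∣≡0⇒i≡0; i-j≡0⇒i≡j;
         +-assoc; +-identityʳ; +-inverseˡ; +-inverseʳ; pos-*)
open import Data.Integer.DivMod using (n%ℕd<d; a≡a%ℕn+[a/ℕn]*n)
open import Data.Integer.Tactic.RingSolver using (solve)
open import Data.Parity.Base as ℙ using (Parity; 0ℙ; 1ℙ)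
open import Data.Parity.Properties using (+-homo-+)
open import Data.Fin.Base using (Fin; toℕ; fromℕ<)
open import Data.Fin.Properties using (toℕ-injective; toℕ-fromℕ<; toℕ<n)
open import Data.List.Base using (_∷_; [])
open import Data.Product using (Σ; _,_)
open import Data.Sum using (inj₁; inj₂)
open import Data.Empty using (⊥-elim)
open import Function.Bundles using (Inverse; mk↔ₛ′)
open import Relation.Binary.PropositionalEquality
open ≡-Reasoning

difference-of-representations : ∀ (r r′ q q′ D : ℤ) →
  r + q * D ≡ r′ + q′ * D → r - r′ ≡ (q′ - q) * D
difference-of-representations r r′ q q′ D eq = begin
  r - r′                          ≡⟨ solve (r ∷ r′ ∷ q ∷ D ∷ []) ⟩
  (r + q * D) - (r′ + q * D)      ≡⟨ cong (λ x → x - (r′ + q * D)) eq ⟩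
  (r′ + q′ * D) - (r′ + q * D)    ≡⟨ solve (r′ ∷ q ∷ q′ ∷ D ∷ []) ⟩
  (q′ - q) * D                    ∎

small-multiple : ∀ m d → m ℕ.* d ℕ.< d → m ℕ.* d ≡ 0
small-multiple zero    d _  = refl
small-multiple (suc m) d md<d = ⊥-elim (ℕ.≤⇒≯ (ℕ.m≤m+n d (m ℕ.* d)) md<d)

-- Remainders in [0, d) are unique: two of them differ by a multiple of d
-- of absolute value below d, hence by 0.
remainder-unique : ∀ d {r r′} (q q′ : ℤ) → r ℕ.< d → r′ ℕ.< d →
                   + r + q * + d ≡ + r′ + q′ * + d → r ≡ r′
remainder-unique d {r} {r′} q q′ r<d r′<d eq =
  +-injective (i-j≡0⇒i≡j (+ r) (+ r′) (∣i∣≡0⇒i≡0 ∣δ∣≡0))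
  where
  δ≡ : + r - + r′ ≡ (q′ - q) * + d
  δ≡ = difference-of-representations (+ r) (+ r′) q q′ (+ d) eq
  ∣δ∣≡ : ∣ + r - + r′ ∣ ≡ ∣ q′ - q ∣ ℕ.* d
  ∣δ∣≡ = trans (cong ∣_∣ δ≡) (∣i*j∣≡∣i∣*∣j∣ (q′ - q) (+ d))
  ∣δ∣<d : ∣ + r - + r′ ∣ ℕ.< d
  ∣δ∣<d = ℕ.≤-<-trans (subst (ℕ._≤ r ℕ.⊔ r′) (cong ∣_∣ (sym (m-n≡m⊖n r r′)))
                                (∣m⊝n∣≤m⊔n r r′))
                      (ℕ.⊔-lub r<d r′<d)
  ∣δ∣≡0 : ∣ + r - + r′ ∣ ≡ 0
  ∣δ∣≡0 = trans ∣δ∣≡ (small-multiple ∣ q′ - q ∣ d (subst (ℕ._< d) ∣δ∣≡ ∣δ∣<d))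

%ℕ-shift : ∀ d .{{_ : NonZero d}} a q → (a + q * + d) %ℕ d ≡ a %ℕ d
%ℕ-shift d a q = remainder-unique d ((a + q * + d) /ℕ d) (a /ℕ d + q)
  (n%ℕd<d (a + q * + d) d) (n%ℕd<d a d) (begin
    + ((a + q * + d) %ℕ d) + ((a + q * + d) /ℕ d) * + d
      ≡⟨ sym (a≡a%ℕn+[a/ℕn]*n (a + q * + d) d) ⟩
    a + q * + d
      ≡⟨ cong (_+ q * + d) (a≡a%ℕn+[a/ℕn]*n a d) ⟩
    + (a %ℕ d) + (a /ℕ d) * + d + q * + d
      ≡⟨ regroup (+ (a %ℕ d)) (a /ℕ d) q (+ d) ⟩
    + (a %ℕ d) + (a /ℕ d + q) * + d ∎)
  where
  regroup : ∀ r Q q D → r + Q * D + q * D ≡ r + (Q + q) * D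
  regroup r Q q D = solve (r ∷ Q ∷ q ∷ D ∷ [])

module Congruence (N : ℤ) where

  infix 4 _≋_
  record _≋_ (a b : ℤ) : Set where
    constructor congruent
    field
      multiplier : ℤ
      difference : a ≡ b + multiplier * N

  ≡⇒≋ : ∀ {a b} → a ≡ b → a ≋ b
  ≡⇒≋ {b = b} refl = congruent (+ 0) (solve (b ∷ N ∷ []))

  ≋-sym : ∀ {a b} → a ≋ b → b ≋ a
  ≋-sym {b = b} (congruent c refl) = congruent (- c) (solve (b ∷ c ∷ N ∷ []))

  ≋-trans : ∀ {a b e} → a ≋ b → b ≋ e → a ≋ e
  ≋-trans {e = e} (congruent c refl) (congruent c′ refl) =
    congruent (c′ + c) (solve (e ∷ c ∷ c′ ∷ N ∷ []))

  ≋-+ʳ : ∀ {a b} z → a ≋ b → a + z ≋ b + z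
  ≋-+ʳ {b = b} z (congruent c refl) = congruent c (solve (b ∷ c ∷ z ∷ N ∷ []))

  ≋-reflect : ∀ {a b} z → a ≋ b → z - a ≋ z - b
  ≋-reflect {b = b} z (congruent c refl) = congruent (- c) (solve (b ∷ c ∷ z ∷ N ∷ []))

module Residues (n : ℕ) .{{_ : NonZero n}} where

  open Congruence (+ n) public

  ⟦_⟧ : ℤ → Fin n
  ⟦ a ⟧ = fromℕ< (n%ℕd<d a n)

  toℤ : Fin n → ℤ
  toℤ i = + toℕ i

  ⟦⟧-cong : ∀ {a b} → a ≋ b → ⟦ a ⟧ ≡ ⟦ b ⟧
  ⟦⟧-cong {b = b} (congruent c refl) = toℕ-injective (begin
    toℕ ⟦ b + c * + n ⟧   ≡⟨ toℕ-fromℕ< _ ⟩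
    (b + c * + n) %ℕ n    ≡⟨ %ℕ-shift n b c ⟩
    b %ℕ n                ≡⟨ toℕ-fromℕ< _ ⟨
    toℕ ⟦ b ⟧             ∎)

  toℤ-⟦⟧ : ∀ a → toℤ ⟦ a ⟧ ≋ a
  toℤ-⟦⟧ a = subst (_≋ a) (cong +_ (sym (toℕ-fromℕ< _)))
                    (≋-sym (congruent (a /ℕ n) (a≡a%ℕn+[a/ℕn]*n a n)))

  ⟦⟧-toℤ : ∀ i → ⟦ toℤ i ⟧ ≡ i
  ⟦⟧-toℤ i = toℕ-injective (trans (toℕ-fromℕ< _) (m<n⇒m%n≡m (toℕ<n i)))

  ⟦+⟧ : ∀ m → ⟦ + m ⟧ ≡ m mod n
  ⟦+⟧ m = toℕ-injective (trans (toℕ-fromℕ< _) (sym (toℕ-fromℕ< _)))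

-- Parity of integers, as an additive homomorphism ℤ → ℤ/2 compatible with
-- negation; it selects the branch of the involution σ below.

parityℤ : ℤ → Parity
parityℤ a = parity (a %ℕ 2)

parity-%2 : ∀ m → parity (m % 2) ≡ parity m
parity-%2 zero          = refl
parity-%2 (suc zero)    = refl
parity-%2 (suc (suc m)) = parity-%2 m

parityℤ-even-shift : ∀ a q → parityℤ (a + q * + 2) ≡ parityℤ a
parityℤ-even-shift a q = cong parity (%ℕ-shift 2 a q)

parityℤ-char : ∀ m q → parityℤ (+ m + q * + 2) ≡ parity m
parityℤ-char m q = trans (parityℤ-even-shift (+ m) q) (parity-%2 m)

halve : ∀ a → a ≡ + (a %ℕ 2) + (a /ℕ 2) * + 2
halve a = a≡a%ℕn+[a/ℕn]*n a 2

parityℤ-+ : ∀ a b → parityℤ (a + b) ≡ parityℤ a ℙ.+ parityℤ b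
parityℤ-+ a b = begin
  parityℤ (a + b)                      ≡⟨ cong₂ (λ x y → parityℤ (x + y)) (halve a) (halve b) ⟩
  parityℤ ((r + Q * + 2) + (r′ + Q′ * + 2))  ≡⟨ cong parityℤ (regroup r Q r′ Q′) ⟩
  parityℤ ((r + r′) + (Q + Q′) * + 2)  ≡⟨ parityℤ-char (a %ℕ 2 ℕ.+ b %ℕ 2) (Q + Q′) ⟩
  parity (a %ℕ 2 ℕ.+ b %ℕ 2)           ≡⟨ +-homo-+ (a %ℕ 2) (b %ℕ 2) ⟩
  parityℤ a ℙ.+ parityℤ b              ∎
  where
  r = + (a %ℕ 2)
  r′ = + (b %ℕ 2)
  Q = a /ℕ 2
  Q′ = b /ℕ 2
  regroup : ∀ r Q r′ Q′ → (r + Q * + 2) + (r′ + Q′ * + 2) ≡ (r + r′) + (Q + Q′) * + 2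
  regroup r Q r′ Q′ = solve (r ∷ Q ∷ r′ ∷ Q′ ∷ [])

parityℤ-neg : ∀ a → parityℤ (- a) ≡ parityℤ a
parityℤ-neg a = begin
  parityℤ (- a)                        ≡⟨ cong (λ x → parityℤ (- x)) (halve a) ⟩
  parityℤ (- (r + Q * + 2))            ≡⟨ cong parityℤ (negated r Q) ⟩
  parityℤ (r + (- Q - r) * + 2)        ≡⟨ parityℤ-char (a %ℕ 2) (- Q - r) ⟩
  parityℤ a                            ∎
  where
  r = + (a %ℕ 2)
  Q = a /ℕ 2
  negated : ∀ r Q → - (r + Q * + 2) ≡ r + (- Q - r) * + 2
  negated r Q = solve (r ∷ Q ∷ [])

parityℤ-− : ∀ a b → parityℤ (a - b) ≡ parityℤ a ℙ.+ parityℤ b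
parityℤ-− a b = trans (parityℤ-+ a (- b)) (cong (parityℤ a ℙ.+_) (parityℤ-neg b))

∤2⇒odd : ∀ k → ¬ (2 ∣ k) → parity k ≡ 1ℙ
∤2⇒odd zero          2∤k = ⊥-elim (2∤k (divides 0 refl))
∤2⇒odd (suc zero)    _   = refl
∤2⇒odd (suc (suc k)) 2∤k =
  ∤2⇒odd k (λ { (divides q k≡q2) → 2∤k (divides (suc q) (cong (2 ℕ.+_) k≡q2)) })

module GraphAutomorphisms {V : Set} (Adj : V → V → Set) where

  open Automorphism

  Preserves : (V → V) → Set
  Preserves f = ∀ x y → Adj x y → Adj (f x) (f y)

  -- Two mutually inverse maps that both preserve adjacency form an
  -- automorphism (reflection of adjacency comes from the inverse).
  automorphism : (f g : V → V) → (∀ y → f (g y) ≡ y) → (∀ x → g (f x) ≡ x) →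
                 Preserves f → Preserves g → Automorphism Adj
  automorphism f g fg gf pres-f pres-g = record
    { perm     = mk↔ₛ′ f g fg gf
    ; preserve = pres-f
    ; reflect  = λ x y adj → subst₂ Adj (gf x) (gf y) (pres-g (f x) (f y) adj)
    }

  from-preserves : (φ : Automorphism Adj) → Preserves (from φ)
  from-preserves φ x y adj = reflect φ (from φ x) (from φ y)
    (subst₂ Adj (sym (to∘from x)) (sym (to∘from y)) adj)
    where to∘from = Inverse.strictlyInverseˡ (perm φ)

  infix  10 _⁻¹ᴬ
  infixr 9 _∘ᴬ_

  _⁻¹ᴬ : Automorphism Adj → Automorphism Adj
  φ ⁻¹ᴬ = automorphism (from φ) (to φ)
    (Inverse.strictlyInverseʳ (perm φ)) (Inverse.strictlyInverseˡ (perm φ))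
    (from-preserves φ) (preserve φ)

  _∘ᴬ_ : Automorphism Adj → Automorphism Adj → Automorphism Adj
  ψ ∘ᴬ φ = automorphism (λ x → to ψ (to φ x)) (λ x → from φ (from ψ x))
    (λ y → trans (cong (to ψ) (Inverse.strictlyInverseˡ (perm φ) (from ψ y)))
                 (Inverse.strictlyInverseˡ (perm ψ) y))
    (λ x → trans (cong (from φ) (Inverse.strictlyInverseʳ (perm ψ) (to φ x)))
                 (Inverse.strictlyInverseʳ (perm φ) x))
    (λ x y adj → preserve ψ _ _ (preserve φ x y adj))
    (λ x y adj → from-preserves φ _ _ (from-preserves ψ x y adj))

  -- If every vertex can be moved to a fixed base vertex, the graph is
  -- vertex-transitive: move x to the base, then the base back to y.
  transitive-via : (base : V) → (∀ x → Σ (Automorphism Adj) λ φ → to φ x ≡ base) →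
                   VertexTransitive Adj
  transitive-via base reach x y with reach x | reach y
  ... | φ , φx≡b | ψ , ψy≡b = ψ ⁻¹ᴬ ∘ᴬ φ , (begin
    from ψ (to φ x)  ≡⟨ cong (from ψ) φx≡b ⟩
    from ψ base      ≡⟨ cong (from ψ) ψy≡b ⟨
    from ψ (to ψ y)  ≡⟨ Inverse.strictlyInverseʳ (perm ψ) y ⟩
    y                ∎)

module AutomorphismsOfY (k : ℕ) .{{_ : NonZero k}} (k-odd : parity k ≡ 1ℙ) where

  n : ℕ
  n = 2 ℕ.* k

  instance
    n≢0 : NonZero n
    n≢0 = ℕ.m*n≢0 2 k

  open Residues n
  open GraphAutomorphisms (Y k)

  V : Set
  V = Vertex k

  Adj : V → V → Set
  Adj = Y k

  K : ℤ
  K = + k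

  infixl 6 _⊕ₖ_
  _⊕ₖ_ : Fin n → ℕ → Fin n
  _⊕ₖ_ = _⊕_ {k}

  infix 5 _at_
  _at_ : Kind → ℤ → V
  t at a = t , ⟦ a ⟧

  ≋-via : ∀ {a b} c → a ≡ b + c * (+ 2 * K) → a ≋ b
  ≋-via {b = b} c eq = congruent c (trans eq (cong (λ N → b + c * N) (sym (pos-* 2 k))))

  -- congruent integers have the same parity, n being even
  parityℤ-≋ : ∀ {a b} → a ≋ b → parityℤ a ≡ parityℤ b
  parityℤ-≋ {b = b} (congruent c refl) = begin
    parityℤ (b + c * + n)          ≡⟨ cong (λ N → parityℤ (b + c * N)) (pos-* 2 k) ⟩
    parityℤ (b + c * (+ 2 * K))    ≡⟨ cong parityℤ (regroup b c K) ⟩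
    parityℤ (b + (c * K) * + 2)    ≡⟨ parityℤ-even-shift b (c * K) ⟩
    parityℤ b                      ∎
    where
    regroup : ∀ b c K → b + c * (+ 2 * K) ≡ b + (c * K) * + 2
    regroup b c K = solve (b ∷ c ∷ K ∷ [])

  ⊕-at : ∀ i r → i ⊕ₖ r ≡ ⟦ toℤ i + + r ⟧
  ⊕-at i r = sym (⟦+⟧ (toℕ i ℕ.+ r))

  ⊕-≋ : ∀ i r → toℤ (i ⊕ₖ r) ≋ toℤ i + + r
  ⊕-≋ i r = subst (λ j → toℤ j ≋ toℤ i + + r) (sym (⊕-at i r)) (toℤ-⟦⟧ _)

  adj-sym : ∀ {x y} → Adj x y → Adj y x
  adj-sym (inj₁ e) = inj₂ e
  adj-sym (inj₂ e) = inj₁ e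

  shift-at : ∀ {a b} r → a + + r ≋ b → ⟦ a ⟧ ⊕ₖ r ≡ ⟦ b ⟧
  shift-at {a} r h = trans (⊕-at ⟦ a ⟧ r) (⟦⟧-cong (≋-trans (≋-+ʳ (+ r) (toℤ-⟦⟧ a)) h))

  adj-ww : ∀ a b → a + K ≋ b → Adj (w at a) (w at b)
  adj-ww a b h = subst (λ j → Adj (w at a) (w , j)) (shift-at {a} k h) (inj₁ (e-ww ⟦ a ⟧))

  adj-uv : ∀ a b → a ≋ b → Adj (u at a) (v at b)
  adj-uv a b h = subst (λ j → Adj (u at a) (v , j)) (⟦⟧-cong h) (inj₁ (e-uv ⟦ a ⟧))

  adj-uw : ∀ a b → a ≋ b → Adj (u at a) (w at b)
  adj-uw a b h = subst (λ j → Adj (u at a) (w , j)) (⟦⟧-cong h) (inj₁ (e-uw ⟦ a ⟧))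

  adj-uw₂ : ∀ a b → a + + 2 ≋ b → Adj (u at a) (w at b)
  adj-uw₂ a b h = subst (λ j → Adj (u at a) (w , j)) (shift-at {a} 2 h) (inj₁ (e-uwr ⟦ a ⟧))

  adj-vv : ∀ a b → a + + 1 ≋ b → Adj (v at a) (v at b)
  adj-vv a b h = subst (λ j → Adj (v at a) (v , j)) (shift-at {a} 1 h) (inj₁ (e-vv ⟦ a ⟧))

  preserves-edges : (f : V → V) → (∀ {x y} → Edge k 2 1 x y → Adj (f x) (f y)) → Preserves f
  preserves-edges f edge x y (inj₁ e) = edge e
  preserves-edges f edge x y (inj₂ e) = adj-sym (edge e)

  ρ : ℤ → V → V
  ρ z (t , i) = t at (toℤ i + z)

  ρ-at : ∀ z t a → ρ z (t at a) ≡ t at (a + z)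
  ρ-at z t a = cong (t ,_) (⟦⟧-cong (≋-+ʳ z (toℤ-⟦⟧ a)))

  ρ-cancel : ∀ z z′ → z + z′ ≡ + 0 → ∀ x → ρ z′ (ρ z x) ≡ x
  ρ-cancel z z′ z+z′≡0 (t , i) = begin
    ρ z′ (t at (toℤ i + z))   ≡⟨ ρ-at z′ t (toℤ i + z) ⟩
    t at (toℤ i + z + z′)     ≡⟨ cong (t at_) (+-assoc (toℤ i) z z′) ⟩
    t at (toℤ i + (z + z′))   ≡⟨ cong (λ c → t at (toℤ i + c)) z+z′≡0 ⟩
    t at (toℤ i + + 0)        ≡⟨ cong (t at_) (+-identityʳ (toℤ i)) ⟩
    t , ⟦ toℤ i ⟧             ≡⟨ cong (t ,_) (⟦⟧-toℤ i) ⟩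
    t , i                     ∎

  ρ-shift : ∀ z i r → (toℤ i + z) + + r ≋ toℤ (i ⊕ₖ r) + z
  ρ-shift z i r = ≋-trans (≡⇒≋ (swap (toℤ i) z (+ r))) (≋-+ʳ z (≋-sym (⊕-≋ i r)))
    where
    swap : ∀ x z r → (x + z) + r ≡ (x + r) + z
    swap x z r = solve (x ∷ z ∷ r ∷ [])

  ρ-edge : ∀ z {x y} → Edge k 2 1 x y → Adj (ρ z x) (ρ z y)
  ρ-edge z (e-ww i)  = adj-ww  (toℤ i + z) _ (ρ-shift z i k)
  ρ-edge z (e-uv i)  = adj-uv  (toℤ i + z) _ (≡⇒≋ refl)
  ρ-edge z (e-uw i)  = adj-uw  (toℤ i + z) _ (≡⇒≋ refl)
  ρ-edge z (e-uwr i) = adj-uw₂ (toℤ i + z) _ (ρ-shift z i 2)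
  ρ-edge z (e-vv i)  = adj-vv  (toℤ i + z) _ (ρ-shift z i 1)

  ρ-aut : ℤ → Automorphism Adj
  ρ-aut z = automorphism (ρ z) (ρ (- z))
    (ρ-cancel (- z) z (+-inverseˡ z)) (ρ-cancel z (- z) (+-inverseʳ z))
    (preserves-edges (ρ z) (ρ-edge z)) (preserves-edges (ρ (- z)) (ρ-edge (- z)))

  σ-kind : Kind → Parity → Kind
  σ-kind u 0ℙ = v
  σ-kind u 1ℙ = w
  σ-kind v 0ℙ = u
  σ-kind v 1ℙ = w
  σ-kind w 0ℙ = v
  σ-kind w 1ℙ = u

  σ-offset : Kind → Parity → ℤ
  σ-offset u 0ℙ = + 0
  σ-offset u 1ℙ = K + + 1
  σ-offset v 0ℙ = + 0
  σ-offset v 1ℙ = + 1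
  σ-offset w 0ℙ = + 1
  σ-offset w 1ℙ = K + + 1

  σ̂ : Kind → Parity → ℤ → V
  σ̂ t p x = σ-kind t p at (σ-offset t p - x)

  σℤ : Kind → ℤ → V
  σℤ t x = σ̂ t (parityℤ x) x

  σ : V → V
  σ (t , i) = σℤ t (toℤ i)

  -- σℤ is well defined on residues: parity and reflections respect ≋
  σℤ-cong : ∀ t {a b} → a ≋ b → σℤ t a ≡ σℤ t b
  σℤ-cong t {a} {b} h = begin
    σ̂ t (parityℤ a) a   ≡⟨ cong (λ p → σ̂ t p a) (parityℤ-≋ h) ⟩
    σ̂ t (parityℤ b) a
      ≡⟨ cong (σ-kind t (parityℤ b) ,_) (⟦⟧-cong (≋-reflect (σ-offset t (parityℤ b)) h)) ⟩
    σ̂ t (parityℤ b) b   ∎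

  σ-at : ∀ t a → σ (t at a) ≡ σℤ t a
  σ-at t a = σℤ-cong t (toℤ-⟦⟧ a)

  σ-along : ∀ t t′ i r →
    Adj (σ̂ t (parityℤ (toℤ i)) (toℤ i)) (σ̂ t′ (parityℤ (toℤ i) ℙ.+ parity r) (toℤ i + + r)) →
    Adj (σ (t , i)) (σ (t′ , i ⊕ₖ r))
  σ-along t t′ i r adj = subst (Adj (σ (t , i))) (sym σ-far) adj
    where
    x = toℤ i
    σ-far : σ (t′ , i ⊕ₖ r) ≡ σ̂ t′ (parityℤ x ℙ.+ parity r) (x + + r)
    σ-far = begin
      σ (t′ , i ⊕ₖ r)                        ≡⟨ cong (λ j → σ (t′ , j)) (⊕-at i r) ⟩
      σ (t′ at (x + + r))                    ≡⟨ σ-at t′ (x + + r) ⟩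
      σ̂ t′ (parityℤ (x + + r)) (x + + r)     ≡⟨ cong (λ p → σ̂ t′ p (x + + r)) (parityℤ-+ x (+ r)) ⟩
      σ̂ t′ (parityℤ x ℙ.+ parityℤ (+ r)) (x + + r)
        ≡⟨ cong (λ p → σ̂ t′ (parityℤ x ℙ.+ p) (x + + r)) (parity-%2 r) ⟩
      σ̂ t′ (parityℤ x ℙ.+ parity r) (x + + r) ∎

  σ̂-ww : ∀ p x → Adj (σ̂ w p x) (σ̂ w (p ℙ.+ 1ℙ) (x + K))
  σ̂-ww 0ℙ x = adj-sym (adj-uv (K + + 1 - (x + K)) (+ 1 - x) (≡⇒≋ (identity x K)))
    where
    identity : ∀ x K → K + + 1 - (x + K) ≡ + 1 - x
    identity x K = solve (x ∷ K ∷ [])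
  σ̂-ww 1ℙ x = adj-uv (K + + 1 - x) (+ 1 - (x + K)) (≋-via (+ 1) (identity x K))
    where
    identity : ∀ x K → K + + 1 - x ≡ (+ 1 - (x + K)) + + 1 * (+ 2 * K)
    identity x K = solve (x ∷ K ∷ [])

  σ̂-uv : ∀ p x → Adj (σ̂ u p x) (σ̂ v p x)
  σ̂-uv 0ℙ x = adj-sym (adj-uv (+ 0 - x) (+ 0 - x) (≡⇒≋ refl))
  σ̂-uv 1ℙ x = adj-ww (K + + 1 - x) (+ 1 - x) (≋-via (+ 1) (identity x K))
    where
    identity : ∀ x K → K + + 1 - x + K ≡ (+ 1 - x) + + 1 * (+ 2 * K)
    identity x K = solve (x ∷ K ∷ [])

  σ̂-uw : ∀ p x → Adj (σ̂ u p x) (σ̂ w p x)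
  σ̂-uw 0ℙ x = adj-vv (+ 0 - x) (+ 1 - x) (≡⇒≋ (solve (x ∷ [])))
  σ̂-uw 1ℙ x = adj-sym (adj-uw (K + + 1 - x) (K + + 1 - x) (≡⇒≋ refl))

  σ̂-uw₂ : ∀ p x → Adj (σ̂ u p x) (σ̂ w (p ℙ.+ 0ℙ) (x + + 2))
  σ̂-uw₂ 0ℙ x = adj-sym (adj-vv (+ 1 - (x + + 2)) (+ 0 - x) (≡⇒≋ (solve (x ∷ []))))
  σ̂-uw₂ 1ℙ x = adj-sym (adj-uw₂ (K + + 1 - (x + + 2)) (K + + 1 - x) (≡⇒≋ (identity x K)))
    where
    identity : ∀ x K → K + + 1 - (x + + 2) + + 2 ≡ K + + 1 - x
    identity x K = solve (x ∷ K ∷ [])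

  σ̂-vv : ∀ p x → Adj (σ̂ v p x) (σ̂ v (p ℙ.+ 1ℙ) (x + + 1))
  σ̂-vv 0ℙ x = adj-uw (+ 0 - x) (+ 1 - (x + + 1)) (≡⇒≋ (solve (x ∷ [])))
  σ̂-vv 1ℙ x = adj-sym (adj-uw₂ (+ 0 - (x + + 1)) (+ 1 - x) (≡⇒≋ (solve (x ∷ []))))

  -- σ preserves every edge; for w_i w_{i+k} the oddness of k makes the
  -- two ends have opposite parities
  σ-edge : ∀ {x y} → Edge k 2 1 x y → Adj (σ x) (σ y)
  σ-edge (e-ww i)  = σ-along w w i k
    (subst (λ q → Adj (σ̂ w p x) (σ̂ w (p ℙ.+ q) (x + K))) (sym k-odd) (σ̂-ww p x))
    where x = toℤ i ; p = parityℤ x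
  σ-edge (e-uv i)  = σ̂-uv (parityℤ (toℤ i)) (toℤ i)
  σ-edge (e-uw i)  = σ̂-uw (parityℤ (toℤ i)) (toℤ i)
  σ-edge (e-uwr i) = σ-along u w i 2 (σ̂-uw₂ (parityℤ (toℤ i)) (toℤ i))
  σ-edge (e-vv i)  = σ-along v v i 1 (σ̂-vv (parityℤ (toℤ i)) (toℤ i))

  -- σ is an involution: σ̂ pairs (u, even) with (v, even), (u, odd) with
  -- (w, odd) and (v, odd) with (w, even), with matching offsets.

  K+1-even : parityℤ (K + + 1) ≡ 0ℙ
  K+1-even = begin
    parity ((k ℕ.+ 1) % 2)   ≡⟨ parity-%2 (k ℕ.+ 1) ⟩
    parity (k ℕ.+ 1)         ≡⟨ +-homo-+ k 1 ⟩
    parity k ℙ.+ 1ℙ          ≡⟨ cong (ℙ._+ 1ℙ) k-odd ⟩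
    0ℙ                       ∎

  parityℤ-reflect : ∀ c x {p} → parityℤ x ≡ p → parityℤ (c - x) ≡ parityℤ c ℙ.+ p
  parityℤ-reflect c x px = trans (parityℤ-− c x) (cong (parityℤ c ℙ.+_) px)

  σ-reflect-back : ∀ t′ p′ c x → parityℤ (c - x) ≡ p′ → σ-offset t′ p′ ≡ c →
                   σ (t′ at (c - x)) ≡ σ-kind t′ p′ at x
  σ-reflect-back t′ p′ c x parity≡ offset≡ = begin
    σ (t′ at (c - x))                  ≡⟨ σ-at t′ (c - x) ⟩
    σ̂ t′ (parityℤ (c - x)) (c - x)     ≡⟨ cong (λ p → σ̂ t′ p (c - x)) parity≡ ⟩
    σ̂ t′ p′ (c - x)                    ≡⟨ cong (λ o → σ-kind t′ p′ at (o - (c - x))) offset≡ ⟩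
    σ-kind t′ p′ at (c - (c - x))      ≡⟨ cong (σ-kind t′ p′ at_) double-reflection ⟩
    σ-kind t′ p′ at x                  ∎
    where
    double-reflection : c - (c - x) ≡ x
    double-reflection = solve (c ∷ x ∷ [])

  σ̂-involutive : ∀ t p x → parityℤ x ≡ p → σ (σ̂ t p x) ≡ t at x
  σ̂-involutive u 0ℙ x px = σ-reflect-back v 0ℙ (+ 0) x (parityℤ-reflect (+ 0) x px) refl
  σ̂-involutive u 1ℙ x px = σ-reflect-back w 1ℙ (K + + 1) x
    (trans (parityℤ-reflect (K + + 1) x px) (cong (ℙ._+ 1ℙ) K+1-even)) refl
  σ̂-involutive v 0ℙ x px = σ-reflect-back u 0ℙ (+ 0) x (parityℤ-reflect (+ 0) x px) refl
  σ̂-involutive v 1ℙ x px = σ-reflect-back w 0ℙ (+ 1) x (parityℤ-reflect (+ 1) x px) refl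
  σ̂-involutive w 0ℙ x px = σ-reflect-back v 1ℙ (+ 1) x (parityℤ-reflect (+ 1) x px) refl
  σ̂-involutive w 1ℙ x px = σ-reflect-back u 1ℙ (K + + 1) x
    (trans (parityℤ-reflect (K + + 1) x px) (cong (ℙ._+ 1ℙ) K+1-even)) refl

  σ-involutive : ∀ x → σ (σ x) ≡ x
  σ-involutive (t , i) =
    trans (σ̂-involutive t (parityℤ (toℤ i)) (toℤ i) refl) (cong (t ,_) (⟦⟧-toℤ i))

  σ-aut : Automorphism Adj
  σ-aut = automorphism σ σ σ-involutive σ-involutive
    (preserves-edges σ σ-edge) (preserves-edges σ σ-edge)

  -- Every vertex can be moved to u_0: u_i by ρ_{-i}, v_i by σ ∘ ρ_{-i}, and
  -- w_i by σ ∘ ρ_{-1} ∘ σ ∘ ρ_{-i}, since σ w_0 = v_1 and σ v_0 = u_0.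

  base : V
  base = u at + 0

  to-base : ∀ x → Σ (Automorphism Adj) λ φ → Automorphism.to φ x ≡ base
  to-base (u , i) = ρ-aut (- toℤ i) , cong (u at_) (+-inverseʳ (toℤ i))
  to-base (v , i) = σ-aut ∘ᴬ ρ-aut (- toℤ i) , (begin
    σ (v at (toℤ i - toℤ i))   ≡⟨ cong (λ a → σ (v at a)) (+-inverseʳ (toℤ i)) ⟩
    σ (v at + 0)               ≡⟨ σ-at v (+ 0) ⟩
    base                       ∎)
  to-base (w , i) = σ-aut ∘ᴬ ρ-aut (- + 1) ∘ᴬ σ-aut ∘ᴬ ρ-aut (- toℤ i) , (begin
    σ (ρ (- + 1) (σ (w at (toℤ i - toℤ i))))
      ≡⟨ cong (λ a → σ (ρ (- + 1) (σ (w at a)))) (+-inverseʳ (toℤ i)) ⟩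
    σ (ρ (- + 1) (σ (w at + 0)))   ≡⟨ cong (λ y → σ (ρ (- + 1) y)) (σ-at w (+ 0)) ⟩
    σ (ρ (- + 1) (v at + 1))       ≡⟨ cong σ (ρ-at (- + 1) v (+ 1)) ⟩
    σ (v at + 0)                   ≡⟨ σ-at v (+ 0) ⟩
    base                           ∎)

  vertex-transitive : VertexTransitive Adj
  vertex-transitive = transitive-via base to-base

-- Y(k) is vertex-transitive for every odd k.
lemma5p4 : (k : ℕ) .{{_ : NonZero k}} → 9 ≤ k → ¬ (2 ∣ k) →
             VertexTransitive (Y k)
lemma5p4 k _ 2∤k = AutomorphismsOfY.vertex-transitive k (∤2⇒odd k 2∤k)
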